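{- For every integer $n\ge 1$ and every $k\ge 1$, the number of $e\in\mathbf{I}_n(021)$ having exactly $k$ entries equal to $0$ equals the number of Schröder $(n-1)$-paths having exactly $k-1$ peaks.
   Context: An inversion sequence of length $n$ is an integer sequence $e=(e_1,\ldots,e_n)$ with $0 \le e_i < i$ for all $i$; $\mathbf{I}_n$ is the set of these. $\mathbf{I}_n(021)$ is the set of $e\in\mathbf{I}_n$ with no indices $i<j<k$ such that $e_i<e_k<e_j$. A Schröder $m$-path is a lattice path from $(0,0)$ to $(2m,0)$ never going below the $x$-axis, with steps $U=(1,1)$, $D=(1,-1)$, $F=(2,0)$, written as a word in $U,D,F$. A peak is an occurrence of a $U$ step immediately followed by a $D$ step. -}

module Defs where

open import Data.Nat using (ℕ; zero; suc; _+_; _<ᵇ_; _≡ᵇ_)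
open import Data.List using (List; []; _∷_; length; map; concatMap; upTo; _++_; [_])
open import Data.Bool using (Bool; true; false; _∧_; _∨_; not; if_then_else_)

count : {A : Set} → (A → Bool) → List A → ℕ
count p [] = zero
count p (x ∷ xs) = if p x then suc (count p xs) else count p xs

anyᵇ : {A : Set} → (A → Bool) → List A → Bool
anyᵇ p [] = false
anyᵇ p (x ∷ xs) = p x ∨ anyᵇ p xs

-- invSeqs n lists every e = (e₁,…,eₙ) with 0 ≤ eᵢ < i exactly once
-- (the set 𝐈ₙ), built by appending the last entry eₙ ∈ {0,…,n-1}.
invSeqs : ℕ → List (List ℕ)
invSeqs zero = [ [] ]
invSeqs (suc n) = concatMap (λ v → map (λ e → v ++ [ e ]) (upTo (suc n))) (invSeqs n)

has021From : ℕ → List ℕ → Bool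
has021From a [] = false
has021From a (b ∷ rest) = anyᵇ (λ c → (a <ᵇ c) ∧ (c <ᵇ b)) rest ∨ has021From a rest

-- Does e contain indices i<j<k with e_i < e_k < e_j (pattern 021)?
contains021 : List ℕ → Bool
contains021 [] = false
contains021 (a ∷ rest) = has021From a rest ∨ contains021 rest

zeros : List ℕ → ℕ
zeros [] = zero
zeros (zero ∷ xs) = suc (zeros xs)
zeros (suc _ ∷ xs) = zeros xs

countInv021 : ℕ → ℕ → ℕ
countInv021 n k = count (λ e → not (contains021 e) ∧ (zeros e ≡ᵇ k)) (invSeqs n)

data Step : Set where
  U D F : Step

words : ℕ → List (List Step)
words zero = [ [] ]
words (suc ℓ) = concatMap (λ w → (U ∷ w) ∷ (D ∷ w) ∷ (F ∷ w) ∷ []) (words ℓ)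

width : Step → ℕ
width F = 2
width _ = 1

totalWidth : List Step → ℕ
totalWidth [] = zero
totalWidth (s ∷ w) = width s + totalWidth w

validFrom : ℕ → List Step → Bool
validFrom zero [] = true
validFrom (suc _) [] = false
validFrom h (U ∷ w) = validFrom (suc h) w
validFrom zero (D ∷ w) = false
validFrom (suc h) (D ∷ w) = validFrom h w
validFrom h (F ∷ w) = validFrom h w

isSchroeder : ℕ → List Step → Bool
isSchroeder m w = (totalWidth w ≡ᵇ (m + m)) ∧ validFrom zero w

peaks : List Step → ℕ
peaks [] = zero
peaks (U ∷ D ∷ w) = suc (peaks (D ∷ w))
peaks (_ ∷ w) = peaks w

-- Every Schröder m-path has at most 2m steps, so all of them occur
-- (exactly once) in words 0, words 1, …, words (2m).
allWordsUpTo : ℕ → List (List Step)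
allWordsUpTo zero = words zero
allWordsUpTo (suc ℓ) = allWordsUpTo ℓ ++ words (suc ℓ)

countSchroeder : ℕ → ℕ → ℕ
countSchroeder m p =
  count (λ w → isSchroeder m w ∧ (peaks w ≡ᵇ p)) (allWordsUpTo (m + m))

module Submission where

-- Coefficientwise, Σ_{e ∈ 𝐈_{n+1}(021)} t^{zeros e} = t · Σ_{Schröder n-paths w} t^{peaks w}.
--
-- We prove this identity of generating polynomials evaluated at an arbitrary
-- natural number t, and then read off coefficients by taking t larger than every
-- coefficient (uniqueness of base-t digits).
--
-- * Inversion side: behind the leading 0, an 021-avoiding sequence with maximum M
--   can be extended by e exactly when e = 0 or e ≥ M.  Only the slack
--   L - max(M,1) matters, which yields transfer numbers I r h with total t · I n 0.
-- * Schröder side: splitting off the first step yields numbers c W h b (width W,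
--   height h, b = "preceded by U"); the total is c (2n) 0 false = Sch n.
-- * Comparison: both Sch and the transfer numbers satisfy a first-passage
--   convolution; hence Sch (j+1) = (1+t) · I j 1 = I (j+1) 0 by strong induction.

open import Defs
open import Data.Nat using (ℕ; zero; suc; _+_; _*_; _∸_; _^_; _≤_; _<_; _⊔_; z≤n; s≤s; _<ᵇ_; _≡ᵇ_)
open import Data.Nat.Properties
open import Data.Nat.DivMod using (_%_; [m+kn]%n≡m%n; m<n⇒m%n≡m)
open import Data.Nat.Solver using (module +-*-Solver)
open import Data.Bool using (Bool; true; false; _∧_; _∨_; not; if_then_else_)
open import Data.Bool.Properties using (∨-assoc; ∨-identityʳ; ∨-zeroʳ; ∧-zeroʳ; ∨-commutativeMonoid)
open import Data.List using (List; []; _∷_; map; concatMap; upTo; applyUpTo; _++_; [_]; length)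
open import Data.List.Relation.Unary.All as All using (All; []; _∷_)
open import Data.List.Relation.Unary.All.Properties using (map⁺; concat⁺; applyUpTo⁺₁)
open import Data.Product using (Σ; _×_; _,_; proj₁; proj₂)
open import Data.Sum using (inj₁; inj₂)
open import Algebra.Bundles using (CommutativeMonoid)
open import Algebra.Properties.CommutativeSemigroup (CommutativeMonoid.commutativeSemigroup ∨-commutativeMonoid) using (interchange)
open import Data.Empty using (⊥; ⊥-elim)
open import Function using (_∘_; id)
open import Relation.Binary.PropositionalEquality hiding ([_])
open +-*-Solver using (solve; _:+_; _:*_; _:=_; con)
open ≡-Reasoning

lsum : {A : Set} → (A → ℕ) → List A → ℕ
lsum f [] = 0
lsum f (x ∷ xs) = f x + lsum f xs

lsum-++ : ∀ {A : Set} (f : A → ℕ) xs ys → lsum f (xs ++ ys) ≡ lsum f xs + lsum f ys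
lsum-++ f [] ys = refl
lsum-++ f (x ∷ xs) ys = trans (cong (f x +_) (lsum-++ f xs ys)) (sym (+-assoc (f x) _ _))

lsum-concatMap : ∀ {A B : Set} (f : B → ℕ) (g : A → List B) xs →
  lsum f (concatMap g xs) ≡ lsum (λ x → lsum f (g x)) xs
lsum-concatMap f g [] = refl
lsum-concatMap f g (x ∷ xs) =
  trans (lsum-++ f (g x) (concatMap g xs)) (cong (lsum f (g x) +_) (lsum-concatMap f g xs))

lsum-map : ∀ {A B : Set} (f : B → ℕ) (g : A → B) xs → lsum f (map g xs) ≡ lsum (f ∘ g) xs
lsum-map f g [] = refl
lsum-map f g (x ∷ xs) = cong (f (g x) +_) (lsum-map f g xs)

lsum-cong : ∀ {A : Set} {f g : A → ℕ} xs → (∀ x → f x ≡ g x) → lsum f xs ≡ lsum g xs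
lsum-cong [] eq = refl
lsum-cong (x ∷ xs) eq = cong₂ _+_ (eq x) (lsum-cong xs eq)

lsum-congᴾ : ∀ {A : Set} {P : A → Set} {f g : A → ℕ} {xs} →
  All P xs → (∀ x → P x → f x ≡ g x) → lsum f xs ≡ lsum g xs
lsum-congᴾ [] eq = refl
lsum-congᴾ {xs = x ∷ xs} (px ∷ pxs) eq = cong₂ _+_ (eq x px) (lsum-congᴾ pxs eq)

lsum-+ : ∀ {A : Set} (f g : A → ℕ) xs → lsum (λ x → f x + g x) xs ≡ lsum f xs + lsum g xs
lsum-+ f g [] = refl
lsum-+ f g (x ∷ xs) rewrite lsum-+ f g xs =
  solve 4 (λ a b c d → (a :+ b) :+ (c :+ d) := (a :+ c) :+ (b :+ d)) refl (f x) (g x) (lsum f xs) (lsum g xs)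

lsum-* : ∀ {A : Set} (c : ℕ) (f : A → ℕ) xs → lsum (λ x → c * f x) xs ≡ c * lsum f xs
lsum-* c f [] = sym (*-zeroʳ c)
lsum-* c f (x ∷ xs) rewrite lsum-* c f xs = sym (*-distribˡ-+ c (f x) (lsum f xs))

lsum-zero : ∀ {A : Set} (xs : List A) → lsum (λ _ → 0) xs ≡ 0
lsum-zero [] = refl
lsum-zero (x ∷ xs) = lsum-zero xs

if-* : ∀ (b : Bool) k y → (if b then k * y else 0) ≡ k * (if b then y else 0)
if-* true k y = refl
if-* false k y = sym (*-zeroʳ k)

sumTo : (ℕ → ℕ) → ℕ → ℕ
sumTo f zero = 0
sumTo f (suc n) = f 0 + sumTo (f ∘ suc) n

lsum-applyUpTo : ∀ (f g : ℕ → ℕ) n → lsum f (applyUpTo g n) ≡ sumTo (f ∘ g) n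
lsum-applyUpTo f g zero = refl
lsum-applyUpTo f g (suc n) = cong (f (g 0) +_) (lsum-applyUpTo f (g ∘ suc) n)

sumTo-cong< : ∀ {f g : ℕ → ℕ} n → (∀ i → i < n → f i ≡ g i) → sumTo f n ≡ sumTo g n
sumTo-cong< zero eq = refl
sumTo-cong< (suc n) eq = cong₂ _+_ (eq 0 (s≤s z≤n)) (sumTo-cong< n (λ i i<n → eq (suc i) (s≤s i<n)))

sumTo-cong : ∀ {f g : ℕ → ℕ} n → (∀ i → f i ≡ g i) → sumTo f n ≡ sumTo g n
sumTo-cong n eq = sumTo-cong< n (λ i _ → eq i)

sumTo-zero : ∀ n → sumTo (λ _ → 0) n ≡ 0
sumTo-zero zero = refl
sumTo-zero (suc n) = sumTo-zero n

sumTo-+ : ∀ (f g : ℕ → ℕ) n → sumTo (λ i → f i + g i) n ≡ sumTo f n + sumTo g n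
sumTo-+ f g zero = refl
sumTo-+ f g (suc n) rewrite sumTo-+ (f ∘ suc) (g ∘ suc) n =
  solve 4 (λ a b c d → (a :+ b) :+ (c :+ d) := (a :+ c) :+ (b :+ d)) refl (f 0) (g 0) (sumTo (f ∘ suc) n) (sumTo (g ∘ suc) n)

sumTo-* : ∀ (c : ℕ) (f : ℕ → ℕ) n → sumTo (λ i → c * f i) n ≡ c * sumTo f n
sumTo-* c f zero = sym (*-zeroʳ c)
sumTo-* c f (suc n) rewrite sumTo-* c (f ∘ suc) n = sym (*-distribˡ-+ c (f 0) (sumTo (f ∘ suc) n))

sumTo-last : ∀ (f : ℕ → ℕ) n → sumTo f (suc n) ≡ sumTo f n + f n
sumTo-last f zero = +-comm (f 0) 0
sumTo-last f (suc n) rewrite sumTo-last (f ∘ suc) n = sym (+-assoc (f 0) _ _)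

sumTo-dropZeros : ∀ (f : ℕ → ℕ) c n → (∀ i → i < c → f i ≡ 0) → sumTo f (c + n) ≡ sumTo (λ j → f (c + j)) n
sumTo-dropZeros f zero n z = refl
sumTo-dropZeros f (suc c) n z rewrite z 0 (s≤s z≤n) = sumTo-dropZeros (f ∘ suc) c n (λ i i<c → z (suc i) (s≤s i<c))

conv : (ℕ → ℕ) → (ℕ → ℕ) → ℕ → ℕ
conv f g n = sumTo (λ a → f a * g (n ∸ a)) (suc n)

conv-cong : ∀ {f g : ℕ → ℕ} (h : ℕ → ℕ) n → (∀ i → f i ≡ g i) → conv f h n ≡ conv g h n
conv-cong h n eq = sumTo-cong (suc n) (λ a → cong (_* h (n ∸ a)) (eq a))

conv-+ : ∀ (f g h : ℕ → ℕ) n → conv (λ j → f j + g j) h n ≡ conv f h n + conv g h n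
conv-+ f g h n = trans (sumTo-cong (suc n) (λ a → *-distribʳ-+ (h (n ∸ a)) (f a) (g a)))
                       (sumTo-+ (λ a → f a * h (n ∸ a)) (λ a → g a * h (n ∸ a)) (suc n))

conv-* : ∀ (c : ℕ) (f h : ℕ → ℕ) n → conv (λ j → c * f j) h n ≡ c * conv f h n
conv-* c f h n = trans (sumTo-cong (suc n) (λ a → *-assoc c (f a) (h (n ∸ a))))
                       (sumTo-* c (λ a → f a * h (n ∸ a)) (suc n))

∸-unsuc : ∀ k a → a < k → k ∸ a ≡ suc (k ∸ suc a)
∸-unsuc (suc k) zero _ = refl
∸-unsuc (suc k) (suc a) (s≤s a<k) = ∸-unsuc k a a<k

conv-peelLast : ∀ (f g : ℕ → ℕ) k → conv f g k ≡ sumTo (λ a → f a * g (suc (k ∸ suc a))) k + f k * g 0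
conv-peelLast f g k = trans (sumTo-last (λ a → f a * g (k ∸ a)) k)
  (cong₂ (λ x y → x + f k * g y) (sumTo-cong< k (λ a a<k → cong (λ y → f a * g y) (∸-unsuc k a a<k))) (n∸n≡0 k))

conv-combination : ∀ (f g h : ℕ → ℕ) k S n →
  conv (λ j → f j + (k * g j + h j)) S n ≡ conv f S n + (k * conv g S n + conv h S n)
conv-combination f g h k S n =
  trans (conv-+ f (λ j → k * g j + h j) S n)
        (cong (conv f S n +_) (trans (conv-+ (λ j → k * g j) h S n) (cong (_+ conv h S n) (conv-* k g S n))))

weight : {A : Set} → (A → Bool) → (A → ℕ) → ℕ → A → ℕ
weight q st t x = if q x then t ^ st x else 0

countStat : {A : Set} → (A → Bool) → (A → ℕ) → ℕ → List A → ℕ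
countStat q st p = count (λ x → q x ∧ (st x ≡ᵇ p))

count-cons : ∀ {A : Set} (q : A → Bool) x xs → count q (x ∷ xs) ≡ (if q x then 1 else 0) + count q xs
count-cons q x xs with q x
... | true = refl
... | false = refl

-- a count never exceeds the length, so counts are valid base-B digits when B > length
count-≤ : ∀ {A : Set} (q : A → Bool) xs → count q xs ≤ length xs
count-≤ q [] = z≤n
count-≤ q (x ∷ xs) with q x
... | true = s≤s (count-≤ q xs)
... | false = m≤n⇒m≤1+n (count-≤ q xs)

sumTo-indicator : ∀ t a N → a < N → sumTo (λ p → (if a ≡ᵇ p then 1 else 0) * t ^ p) N ≡ t ^ a
sumTo-indicator t zero (suc N) _ = cong (1 +_) (sumTo-zero N)
sumTo-indicator t (suc a) (suc N) (s≤s lt) = begin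
  sumTo (λ p → (if a ≡ᵇ p then 1 else 0) * (t * t ^ p)) N
    ≡⟨ sumTo-cong N (λ p → solve 3 (λ x u y → x :* (u :* y) := u :* (x :* y)) refl (if a ≡ᵇ p then 1 else 0) t (t ^ p)) ⟩
  sumTo (λ p → t * ((if a ≡ᵇ p then 1 else 0) * t ^ p)) N ≡⟨ sumTo-* t _ N ⟩
  t * sumTo (λ p → (if a ≡ᵇ p then 1 else 0) * t ^ p) N ≡⟨ cong (t *_) (sumTo-indicator t a N lt) ⟩
  t * t ^ a ∎

weight-expand : ∀ {A : Set} (q : A → Bool) (st : A → ℕ) t x N → st x < N →
  sumTo (λ p → (if q x ∧ (st x ≡ᵇ p) then 1 else 0) * t ^ p) N ≡ weight q st t x
weight-expand q st t x N lt with q x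
... | true = sumTo-indicator t (st x) N lt
... | false = sumTo-zero N

weightedSum-expand : ∀ {A : Set} (q : A → Bool) (st : A → ℕ) t xs N → lsum st xs < N →
  lsum (weight q st t) xs ≡ sumTo (λ p → countStat q st p xs * t ^ p) N
weightedSum-expand q st t [] N _ = sym (sumTo-zero N)
weightedSum-expand q st t (x ∷ xs) N lt = begin
  weight q st t x + lsum (weight q st t) xs
    ≡⟨ cong₂ _+_ (sym (weight-expand q st t x N (≤-<-trans (m≤m+n (st x) (lsum st xs)) lt)))
                 (weightedSum-expand q st t xs N (≤-<-trans (m≤n+m (lsum st xs) (st x)) lt)) ⟩
  sumTo (λ p → δ p * t ^ p) N + sumTo (λ p → countStat q st p xs * t ^ p) N
    ≡⟨ sym (sumTo-+ _ _ N) ⟩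
  sumTo (λ p → δ p * t ^ p + countStat q st p xs * t ^ p) N
    ≡⟨ sumTo-cong N (λ p → trans (sym (*-distribʳ-+ (t ^ p) (δ p) (countStat q st p xs)))
                                 (cong (_* t ^ p) (sym (count-cons (λ y → q y ∧ (st y ≡ᵇ p)) x xs)))) ⟩
  sumTo (λ p → countStat q st p (x ∷ xs) * t ^ p) N ∎
  where
  δ : ℕ → ℕ
  δ p = if q x ∧ (st x ≡ᵇ p) then 1 else 0

digit-split : ∀ B a b x y → a < B → b < B → a + x * B ≡ b + y * B → a ≡ b × x ≡ y
digit-split (suc B) a b x y a<B b<B eq = a≡b , *-cancelʳ-≡ x y (suc B) (+-cancelˡ-≡ a _ _ (trans eq (cong (_+ y * suc B) (sym a≡b))))
  where
  a≡b : a ≡ b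
  a≡b = begin
    a                     ≡⟨ sym (m<n⇒m%n≡m a<B) ⟩
    a % suc B             ≡⟨ sym ([m+kn]%n≡m%n a x (suc B)) ⟩
    (a + x * suc B) % suc B ≡⟨ cong (_% suc B) eq ⟩
    (b + y * suc B) % suc B ≡⟨ [m+kn]%n≡m%n b y (suc B) ⟩
    b % suc B             ≡⟨ m<n⇒m%n≡m b<B ⟩
    b ∎

sumTo-baseShift : ∀ (a : ℕ → ℕ) B N →
  sumTo (λ p → a p * B ^ p) (suc N) ≡ a 0 + sumTo (λ p → a (suc p) * B ^ p) N * B
sumTo-baseShift a B N = cong₂ _+_ (*-identityʳ (a 0)) (begin
  sumTo (λ p → a (suc p) * (B * B ^ p)) N
    ≡⟨ sumTo-cong N (λ p → solve 3 (λ x u y → x :* (u :* y) := u :* (x :* y)) refl (a (suc p)) B (B ^ p)) ⟩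
  sumTo (λ p → B * (a (suc p) * B ^ p)) N ≡⟨ sumTo-* B _ N ⟩
  B * sumTo (λ p → a (suc p) * B ^ p) N ≡⟨ *-comm B _ ⟩
  sumTo (λ p → a (suc p) * B ^ p) N * B ∎)

digits-unique : ∀ B N (a b : ℕ → ℕ) → (∀ p → a p < B) → (∀ p → b p < B) →
  sumTo (λ p → a p * B ^ p) N ≡ sumTo (λ p → b p * B ^ p) N → ∀ p → p < N → a p ≡ b p
digits-unique B (suc N) a b a<B b<B eq p p<N = digit p p<N
  where
  split : a 0 ≡ b 0 × sumTo (λ p → a (suc p) * B ^ p) N ≡ sumTo (λ p → b (suc p) * B ^ p) N
  split = digit-split B (a 0) (b 0) _ _ (a<B 0) (b<B 0)
            (trans (sym (sumTo-baseShift a B N)) (trans eq (sumTo-baseShift b B N)))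
  digit : ∀ p → p < suc N → a p ≡ b p
  digit zero _ = proj₁ split
  digit (suc p) (s≤s p<N) =
    digits-unique B N (a ∘ suc) (b ∘ suc) (a<B ∘ suc) (b<B ∘ suc) (proj₂ split) p p<N

coefficients-agree : ∀ {A C : Set} (q : A → Bool) (st : A → ℕ) (r : C → Bool) (st′ : C → ℕ) xs ys B →
  length xs < B → length ys < B →
  lsum (weight q st B) xs ≡ lsum (weight r st′ B) ys →
  ∀ p → countStat q st p xs ≡ countStat r st′ p ys
coefficients-agree q st r st′ xs ys B xs<B ys<B eq p =
  digits-unique B N (λ p → countStat q st p xs) (λ p → countStat r st′ p ys)
    (λ p → ≤-<-trans (count-≤ _ xs) xs<B) (λ p → ≤-<-trans (count-≤ _ ys) ys<B)
    (begin
      sumTo (λ p → countStat q st p xs * B ^ p) N ≡⟨ sym (weightedSum-expand q st B xs N (s≤s (≤-trans (m≤n+m _ p) (m≤m+n _ _)))) ⟩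
      lsum (weight q st B) xs                    ≡⟨ eq ⟩
      lsum (weight r st′ B) ys                   ≡⟨ weightedSum-expand r st′ B ys N (s≤s (m≤n+m _ _)) ⟩
      sumTo (λ p → countStat r st′ p ys * B ^ p) N ∎)
    p (s≤s (≤-trans (m≤m+n p _) (m≤m+n _ _)))
  where
  N : ℕ
  N = suc (p + lsum st xs + lsum st′ ys)

anyᵇ-snoc : ∀ (p : ℕ → Bool) xs e → anyᵇ p (xs ++ [ e ]) ≡ anyᵇ p xs ∨ p e
anyᵇ-snoc p [] e = ∨-identityʳ (p e)
anyᵇ-snoc p (x ∷ xs) e rewrite anyᵇ-snoc p xs e = sym (∨-assoc (p x) (anyᵇ p xs) (p e))

anyᵇ-∧ˡ : ∀ x (p : ℕ → Bool) r → anyᵇ (λ b → x ∧ p b) r ≡ x ∧ anyᵇ p r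
anyᵇ-∧ˡ true p r = refl
anyᵇ-∧ˡ false p [] = refl
anyᵇ-∧ˡ false p (_ ∷ r) = anyᵇ-∧ˡ false p r

-- closes021 v e: the new last entry e plays the role of the "1" in an
-- occurrence e_i < e < e_j (i < j) with both earlier entries taken from v
closes021 : List ℕ → ℕ → Bool
closes021 [] e = false
closes021 (a ∷ r) e = anyᵇ (λ b → (a <ᵇ e) ∧ (e <ᵇ b)) r ∨ closes021 r e

has021From-snoc : ∀ a r e →
  has021From a (r ++ [ e ]) ≡ has021From a r ∨ anyᵇ (λ b → (a <ᵇ e) ∧ (e <ᵇ b)) r
has021From-snoc a [] e = refl
has021From-snoc a (b ∷ r) e rewrite anyᵇ-snoc (λ c → (a <ᵇ c) ∧ (c <ᵇ b)) r e | has021From-snoc a r e =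
  interchange (anyᵇ (λ c → (a <ᵇ c) ∧ (c <ᵇ b)) r) ((a <ᵇ e) ∧ (e <ᵇ b))
              (has021From a r) (anyᵇ (λ b → (a <ᵇ e) ∧ (e <ᵇ b)) r)

contains021-snoc : ∀ v e → contains021 (v ++ [ e ]) ≡ contains021 v ∨ closes021 v e
contains021-snoc [] e = refl
contains021-snoc (a ∷ r) e rewrite has021From-snoc a r e | contains021-snoc r e =
  interchange (has021From a r) (anyᵇ (λ b → (a <ᵇ e) ∧ (e <ᵇ b)) r) (contains021 r) (closes021 r e)

zeros-snoc : ∀ v e → zeros (v ++ [ e ]) ≡ zeros v + zeros [ e ]
zeros-snoc [] e = refl
zeros-snoc (zero ∷ v) e = cong suc (zeros-snoc v e)
zeros-snoc (suc x ∷ v) e = zeros-snoc v e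

-- the largest entry (0 for the empty sequence)
maxL : List ℕ → ℕ
maxL [] = 0
maxL (x ∷ xs) = x ⊔ maxL xs

maxL-snoc : ∀ v e → maxL (v ++ [ e ]) ≡ maxL v ⊔ e
maxL-snoc [] e = ⊔-identityʳ e
maxL-snoc (x ∷ v) e rewrite maxL-snoc v e = sym (⊔-assoc x (maxL v) e)

<ᵇ-⊔ : ∀ e x y → (e <ᵇ x) ∨ (e <ᵇ y) ≡ (e <ᵇ (x ⊔ y))
<ᵇ-⊔ e x zero rewrite ⊔-identityʳ x = ∨-identityʳ (e <ᵇ x)
<ᵇ-⊔ e zero (suc y) = refl
<ᵇ-⊔ zero (suc x) (suc y) = refl
<ᵇ-⊔ (suc e) (suc x) (suc y) = <ᵇ-⊔ e x y

exceeds-max : ∀ e r → anyᵇ (e <ᵇ_) r ≡ (e <ᵇ maxL r)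
exceeds-max e [] = refl
exceeds-max e (b ∷ r) rewrite exceeds-max e r = <ᵇ-⊔ e b (maxL r)

closes021-zero : ∀ r → closes021 r 0 ≡ false
closes021-zero [] = refl
closes021-zero (a ∷ r) rewrite anyᵇ-∧ˡ false (0 <ᵇ_) r = closes021-zero r

closes021⇒exceeded : ∀ r e → closes021 r e ≡ true → anyᵇ (e <ᵇ_) r ≡ true
closes021⇒exceeded (a ∷ r) e closes with anyᵇ (e <ᵇ_) r in exceeded
... | true  = ∨-zeroʳ (e <ᵇ a)
... | false = ⊥-elim (false≢true (trans (sym exceeded) (closes021⇒exceeded r e closesʳ)))
  where
  noWitness : anyᵇ (λ b → (a <ᵇ e) ∧ (e <ᵇ b)) r ≡ false
  noWitness = trans (anyᵇ-∧ˡ (a <ᵇ e) (e <ᵇ_) r) (trans (cong ((a <ᵇ e) ∧_) exceeded) (∧-zeroʳ (a <ᵇ e)))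
  closesʳ : closes021 r e ≡ true
  closesʳ = trans (cong (_∨ closes021 r e) (sym noWitness)) closes
  false≢true : false ≡ true → ⊥
  false≢true ()

closes021-after0 : ∀ r e → closes021 (0 ∷ r) e ≡ (0 <ᵇ e) ∧ (e <ᵇ maxL r)
closes021-after0 r zero rewrite anyᵇ-∧ˡ false (0 <ᵇ_) r = closes021-zero r
closes021-after0 r (suc e) = trans (absorb (anyᵇ (suc e <ᵇ_) r) (closes021 r (suc e)) (closes021⇒exceeded r (suc e)))
                                   (exceeds-max (suc e) r)
  where
  absorb : ∀ x y → (y ≡ true → x ≡ true) → x ∨ y ≡ x
  absorb true y _ = refl
  absorb false false _ = refl
  absorb false true y⇒x = sym (y⇒x refl)

<ᵇ-true : ∀ m n → m < n → (m <ᵇ n) ≡ true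
<ᵇ-true zero (suc n) _ = refl
<ᵇ-true (suc m) (suc n) (s≤s m<n) = <ᵇ-true m n m<n

<ᵇ-false : ∀ m n → n ≤ m → (m <ᵇ n) ≡ false
<ᵇ-false m zero _ = refl
<ᵇ-false (suc m) (suc n) (s≤s n≤m) = <ᵇ-false m n n≤m

⊔1≡suc∸1 : ∀ M → M ⊔ 1 ≡ suc (M ∸ 1)
⊔1≡suc∸1 zero = refl
⊔1≡suc∸1 (suc M) = cong suc (⊔-identityʳ M)

<∸1⇒suc< : ∀ i M → i < M ∸ 1 → suc i < M
<∸1⇒suc< i (suc M) i<M = s≤s i<M

bool-cases : ∀ {P : Set} (b : Bool) → (b ≡ false → P) → (b ≡ true → P) → P
bool-cases false whenFalse _ = whenFalse refl
bool-cases true _ whenTrue = whenTrue refl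

-- The inversion-sequence side

Admissible : ℕ → List ℕ → Set
Admissible L v = Σ (List ℕ) (λ rest → v ≡ 0 ∷ rest) × (maxL v ⊔ 1 ≤ L)

admissible-snoc : ∀ {L v e} → Admissible (suc L) v → e < suc (suc L) → Admissible (suc (suc L)) (v ++ [ e ])
admissible-snoc {L} {e = e} ((rest , refl) , bounded) (s≤s e≤L) =
  (rest ++ [ e ] , refl) ,
  subst (λ x → x ⊔ 1 ≤ suc (suc L)) (sym (maxL-snoc (0 ∷ rest) e))
    (⊔-lub (⊔-lub (≤-trans (m≤m⊔n (maxL rest) 1) (m≤n⇒m≤1+n bounded)) (m≤n⇒m≤1+n e≤L)) (s≤s z≤n))

allAdmissible : ∀ L → All (Admissible (suc L)) (invSeqs (suc L))
allAdmissible zero = (([] , refl) , ≤-refl) ∷ []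
allAdmissible (suc L) = concat⁺ (map⁺ (All.map extensions (allAdmissible L)))
  where
  extensions : ∀ {v} → Admissible (suc L) v →
    All (Admissible (suc (suc L))) (map (λ e → v ++ [ e ]) (upTo (suc (suc L))))
  extensions adm = map⁺ (applyUpTo⁺₁ id (suc (suc L)) (admissible-snoc adm))

module InversionSide (t : ℕ) where

  wt : List ℕ → ℕ
  wt = weight (not ∘ contains021) zeros t

  -- After the first entry 0, an 021-avoiding sequence with
  -- maximum M may be extended by e exactly when e = 0 or e ≥ M.  Only the
  -- slack h = L - max(M,1) matters, and I r h is the weighted number of ways
  -- to append r further entries: a new 0 (weight t) raises the slack by one,
  -- a new maximum e resets it to any of h+1, h, …, 1.
  I : ℕ → ℕ → ℕ
  I zero h = 1
  I (suc r) h = t * I r (suc h) + sumTo (λ j → I r (suc h ∸ j)) (suc h)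

  slack : ℕ → List ℕ → ℕ
  slack L v = L ∸ (maxL v ⊔ 1)

  wt-snoc : ∀ v e → wt (v ++ [ e ]) ≡ (if not (contains021 v ∨ closes021 v e) then t ^ (zeros v + zeros [ e ]) else 0)
  wt-snoc v e = cong₂ (λ b k → if not b then t ^ k else 0) (contains021-snoc v e) (zeros-snoc v e)

  extend-avoiding : ∀ r L rest → contains021 (0 ∷ rest) ≡ false → maxL rest ⊔ 1 ≤ L →
    sumTo (λ e → wt ((0 ∷ rest) ++ [ e ]) * I r (slack (suc L) ((0 ∷ rest) ++ [ e ]))) (suc L)
      ≡ wt (0 ∷ rest) * I (suc r) (slack L (0 ∷ rest))
  extend-avoiding r L rest avoids bounded = begin
    G 0 + sumTo (G ∘ suc) L
      ≡⟨ cong (λ n → G 0 + sumTo (G ∘ suc) n) (sym L≡c+suc[h]) ⟩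
    G 0 + sumTo (G ∘ suc) (c + suc h)
      ≡⟨ cong (G 0 +_) (sumTo-dropZeros (G ∘ suc) c (suc h) blocked) ⟩
    G 0 + sumTo (λ j → G (suc (c + j))) (suc h)
      ≡⟨ cong₂ _+_ newZero (sumTo-cong (suc h) newMaximum) ⟩
    w * (t * I r (suc h)) + sumTo (λ j → w * I r (suc h ∸ j)) (suc h)
      ≡⟨ cong (w * (t * I r (suc h)) +_) (sumTo-* w (λ j → I r (suc h ∸ j)) (suc h)) ⟩
    w * (t * I r (suc h)) + w * sumTo (λ j → I r (suc h ∸ j)) (suc h)
      ≡⟨ sym (*-distribˡ-+ w _ _) ⟩
    w * I (suc r) h
      ≡⟨ cong (λ b → (if not b then w else 0) * I (suc r) h) (sym avoids) ⟩
    wt v * I (suc r) h ∎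
    where
    v : List ℕ
    v = 0 ∷ rest
    M : ℕ
    M = maxL rest
    w : ℕ
    w = t ^ zeros v
    c : ℕ
    c = M ∸ 1
    h : ℕ
    h = slack L v
    G : ℕ → ℕ
    G e = wt (v ++ [ e ]) * I r (slack (suc L) (v ++ [ e ]))

    wt-ext : ∀ e → wt (v ++ [ e ]) ≡ (if not ((0 <ᵇ e) ∧ (e <ᵇ M)) then t ^ (zeros v + zeros [ e ]) else 0)
    wt-ext e = trans (wt-snoc v e) (cong (λ b → if not b then t ^ (zeros v + zeros [ e ]) else 0)
                                         (cong₂ _∨_ avoids (closes021-after0 rest e)))

    slack-ext : ∀ e → slack (suc L) (v ++ [ e ]) ≡ suc L ∸ ((M ⊔ e) ⊔ 1)
    slack-ext e = cong (λ x → suc L ∸ (x ⊔ 1)) (maxL-snoc v e)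

    L≡c+suc[h] : c + suc h ≡ L
    L≡c+suc[h] = begin
      c + suc h               ≡⟨ +-suc c h ⟩
      suc c + h               ≡⟨ cong (_+ h) (sym (⊔1≡suc∸1 M)) ⟩
      M ⊔ 1 + (L ∸ (M ⊔ 1))   ≡⟨ m+[n∸m]≡n bounded ⟩
      L ∎

    newZero : G 0 ≡ w * (t * I r (suc h))
    newZero = begin
      G 0                                 ≡⟨ cong₂ _*_ (wt-ext 0) (cong (I r) (slack-ext 0)) ⟩
      t ^ (zeros v + 1) * I r (suc L ∸ ((M ⊔ 0) ⊔ 1))
        ≡⟨ cong₂ (λ k x → t ^ k * I r (suc L ∸ (x ⊔ 1))) (+-comm (zeros v) 1) (⊔-identityʳ M) ⟩
      (t * w) * I r (suc L ∸ (M ⊔ 1))     ≡⟨ cong (λ x → (t * w) * I r x) (+-∸-assoc 1 bounded) ⟩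
      (t * w) * I r (suc h)               ≡⟨ cong (_* I r (suc h)) (*-comm t w) ⟩
      (w * t) * I r (suc h)               ≡⟨ *-assoc w t (I r (suc h)) ⟩
      w * (t * I r (suc h)) ∎

    blocked : ∀ i → i < c → G (suc i) ≡ 0
    blocked i i<c = cong (_* I r (slack (suc L) (v ++ [ suc i ])))
      (trans (wt-ext (suc i)) (cong (λ b → if not b then t ^ (zeros v + 0) else 0) (<ᵇ-true (suc i) M (<∸1⇒suc< i M i<c))))

    newMaximum : ∀ j → G (suc (c + j)) ≡ w * I r (suc h ∸ j)
    newMaximum j = cong₂ _*_ weightKept slackReset
      where
      M≤e : M ≤ suc (c + j)
      M≤e = ≤-trans (≤-trans (m≤m⊔n M 1) (≤-reflexive (⊔1≡suc∸1 M))) (s≤s (m≤m+n c j))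
      weightKept : wt (v ++ [ suc (c + j) ]) ≡ w
      weightKept = trans (wt-ext (suc (c + j)))
        (trans (cong (λ b → if not b then t ^ (zeros v + 0) else 0) (<ᵇ-false (suc (c + j)) M M≤e))
               (cong (t ^_) (+-identityʳ (zeros v))))
      slackReset : I r (slack (suc L) (v ++ [ suc (c + j) ])) ≡ I r (suc h ∸ j)
      slackReset = cong (I r) (begin
        slack (suc L) (v ++ [ suc (c + j) ])     ≡⟨ slack-ext (suc (c + j)) ⟩
        suc L ∸ ((M ⊔ suc (c + j)) ⊔ 1)          ≡⟨ cong (λ x → suc L ∸ (x ⊔ 1)) (m≤n⇒m⊔n≡n M≤e) ⟩
        L ∸ ((c + j) ⊔ 0)                        ≡⟨ cong (L ∸_) (⊔-identityʳ (c + j)) ⟩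
        L ∸ (c + j)                              ≡⟨ cong (_∸ (c + j)) (sym L≡c+suc[h]) ⟩
        (c + suc h) ∸ (c + j)                    ≡⟨ [m+n]∸[m+o]≡n∸o c (suc h) j ⟩
        suc h ∸ j ∎)

  wt-containing : ∀ v → contains021 v ≡ true → wt v ≡ 0
  wt-containing v contains = cong (λ b → if not b then t ^ zeros v else 0) contains

  wt-snoc-containing : ∀ v e → contains021 v ≡ true → wt (v ++ [ e ]) ≡ 0
  wt-snoc-containing v e contains =
    trans (wt-snoc v e) (cong (λ b → if not (b ∨ closes021 v e) then t ^ (zeros v + zeros [ e ]) else 0) contains)

  extend-containing : ∀ r L v → contains021 v ≡ true →
    sumTo (λ e → wt (v ++ [ e ]) * I r (slack (suc L) (v ++ [ e ]))) (suc L)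
      ≡ wt v * I (suc r) (slack L v)
  extend-containing r L v contains = begin
    sumTo (λ e → wt (v ++ [ e ]) * I r (slack (suc L) (v ++ [ e ]))) (suc L)
      ≡⟨ sumTo-cong (suc L) (λ e → cong (_* I r (slack (suc L) (v ++ [ e ]))) (wt-snoc-containing v e contains)) ⟩
    sumTo (λ _ → 0) (suc L)       ≡⟨ sumTo-zero (suc L) ⟩
    0                             ≡⟨ cong (_* I (suc r) (slack L v)) (sym (wt-containing v contains)) ⟩
    wt v * I (suc r) (slack L v) ∎

  extend : ∀ r L v → Admissible (suc L) v →
    sumTo (λ e → wt (v ++ [ e ]) * I r (slack (suc (suc L)) (v ++ [ e ]))) (suc (suc L))
      ≡ wt v * I (suc r) (slack (suc L) v)
  extend r L .(0 ∷ rest) ((rest , refl) , bounded) =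
    bool-cases (contains021 (0 ∷ rest))
      (λ avoids → extend-avoiding r (suc L) rest avoids bounded)
      (extend-containing r (suc L) (0 ∷ rest))

  transfer : ∀ r L → lsum wt (invSeqs (r + suc L)) ≡ lsum (λ v → wt v * I r (slack (suc L) v)) (invSeqs (suc L))
  transfer zero L = lsum-cong (invSeqs (suc L)) (λ v → sym (*-identityʳ (wt v)))
  transfer (suc r) L = begin
    lsum wt (invSeqs (suc r + suc L))   ≡⟨ cong (λ n → lsum wt (invSeqs n)) (sym (+-suc r (suc L))) ⟩
    lsum wt (invSeqs (r + suc (suc L))) ≡⟨ transfer r (suc L) ⟩
    lsum wtExt (invSeqs (suc (suc L)))
      ≡⟨ lsum-concatMap wtExt (λ v → map (λ e → v ++ [ e ]) (upTo (suc (suc L)))) (invSeqs (suc L)) ⟩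
    lsum (λ v → lsum wtExt (map (λ e → v ++ [ e ]) (upTo (suc (suc L))))) (invSeqs (suc L))
      ≡⟨ lsum-cong (invSeqs (suc L)) (λ v → trans (lsum-map wtExt (λ e → v ++ [ e ]) (upTo (suc (suc L))))
                                                  (lsum-applyUpTo (λ e → wtExt (v ++ [ e ])) id (suc (suc L)))) ⟩
    lsum (λ v → sumTo (λ e → wtExt (v ++ [ e ])) (suc (suc L))) (invSeqs (suc L))
      ≡⟨ lsum-congᴾ (allAdmissible L) (extend r L) ⟩
    lsum (λ v → wt v * I (suc r) (slack (suc L) v)) (invSeqs (suc L)) ∎
    where
    wtExt : List ℕ → ℕ
    wtExt v = wt v * I r (slack (suc (suc L)) v)

  -- Σ_{e ∈ 𝐈_{m+1}(021)} t^{zeros e} = t · I m 0   (𝐈₁ = {(0)} has weight t and slack 0)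
  inversionTotal : ∀ m → lsum wt (invSeqs (suc m)) ≡ t * I m 0
  inversionTotal m = begin
    lsum wt (invSeqs (suc m))  ≡⟨ cong (λ n → lsum wt (invSeqs n)) (+-comm 1 m) ⟩
    lsum wt (invSeqs (m + 1))  ≡⟨ transfer m 0 ⟩
    (t * 1) * I m 0 + 0        ≡⟨ +-identityʳ _ ⟩
    (t * 1) * I m 0            ≡⟨ cong (_* I m 0) (*-identityʳ t) ⟩
    t * I m 0 ∎

-- The Schröder side

firstSteps : (List Step → ℕ) → List Step → ℕ
firstSteps f w = lsum f ((U ∷ w) ∷ (D ∷ w) ∷ (F ∷ w) ∷ [])

lsum-allWordsUpTo-suc : ∀ (f : List Step → ℕ) L →
  lsum f (allWordsUpTo (suc L)) ≡ f [] + lsum (firstSteps f) (allWordsUpTo L)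
lsum-allWordsUpTo-suc f zero = begin
  lsum f (words zero ++ words 1)      ≡⟨ lsum-++ f (words zero) (words 1) ⟩
  (f [] + 0) + lsum f (words 1)       ≡⟨ cong₂ _+_ (+-identityʳ (f [])) (lsum-concatMap f (λ w → (U ∷ w) ∷ (D ∷ w) ∷ (F ∷ w) ∷ []) (words zero)) ⟩
  f [] + lsum (firstSteps f) (words zero) ∎
lsum-allWordsUpTo-suc f (suc L) = begin
  lsum f (allWordsUpTo (suc L) ++ words (suc (suc L)))
    ≡⟨ lsum-++ f (allWordsUpTo (suc L)) (words (suc (suc L))) ⟩
  lsum f (allWordsUpTo (suc L)) + lsum f (words (suc (suc L)))
    ≡⟨ cong₂ _+_ (lsum-allWordsUpTo-suc f L) (lsum-concatMap f (λ w → (U ∷ w) ∷ (D ∷ w) ∷ (F ∷ w) ∷ []) (words (suc L))) ⟩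
  (f [] + lsum (firstSteps f) (allWordsUpTo L)) + lsum (firstSteps f) (words (suc L))
    ≡⟨ +-assoc (f []) _ _ ⟩
  f [] + (lsum (firstSteps f) (allWordsUpTo L) + lsum (firstSteps f) (words (suc L)))
    ≡⟨ cong (f [] +_) (sym (lsum-++ (firstSteps f) (allWordsUpTo L) (words (suc L)))) ⟩
  f [] + lsum (firstSteps f) (allWordsUpTo (suc L)) ∎

module SchroederSide (t : ℕ) where

  -- The flag b records whether the path is preceded by a U step, so that a
  -- first D step completes a peak; such a D step carries the weight tᵇ.
  tᵇ : Bool → ℕ
  tᵇ true = t
  tᵇ false = 1

  peaksAfter : Bool → List Step → ℕ
  peaksAfter true w = peaks (U ∷ w)
  peaksAfter false w = peaks w

  pathWt : ℕ → ℕ → Bool → List Step → ℕ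
  pathWt h W b w = if (totalWidth w ≡ᵇ W) ∧ validFrom h w then t ^ peaksAfter b w else 0

  c : ℕ → ℕ → Bool → ℕ
  afterD : ℕ → ℕ → Bool → ℕ
  afterF : ℕ → ℕ → ℕ

  c zero zero b = 1
  c zero (suc h) b = 0
  c (suc W) h b = c W (suc h) true + (afterD W h b + afterF W h)

  afterD W zero b = 0
  afterD W (suc h) b = tᵇ b * c W h false

  afterF zero h = 0
  afterF (suc W) h = c W h false

  afterDWt : ℕ → ℕ → Bool → List Step → ℕ
  afterDWt W zero b w = 0
  afterDWt W (suc h) b w = tᵇ b * pathWt h W false w

  afterFWt : ℕ → ℕ → List Step → ℕ
  afterFWt zero h w = 0
  afterFWt (suc W) h w = pathWt h W false w

  pathWt-U : ∀ h W b w → pathWt h (suc W) b (U ∷ w) ≡ pathWt (suc h) W true w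
  pathWt-U zero W true w = refl
  pathWt-U zero W false w = refl
  pathWt-U (suc h) W true w = refl
  pathWt-U (suc h) W false w = refl

  pathWt-D : ∀ h W b w → pathWt h (suc W) b (D ∷ w) ≡ afterDWt W h b w
  pathWt-D zero W b w = cong (λ x → if x then t ^ peaksAfter b (D ∷ w) else 0) (∧-zeroʳ (totalWidth w ≡ᵇ W))
  pathWt-D (suc h) W true w = if-* ((totalWidth w ≡ᵇ W) ∧ validFrom h w) t (t ^ peaks w)
  pathWt-D (suc h) W false w = sym (*-identityˡ _)

  pathWt-F : ∀ h W b w → pathWt h (suc W) b (F ∷ w) ≡ afterFWt W h w
  pathWt-F h zero b w = refl
  pathWt-F zero (suc W) true w = refl
  pathWt-F zero (suc W) false w = refl
  pathWt-F (suc h) (suc W) true w = refl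
  pathWt-F (suc h) (suc W) false w = refl

  emptyPath : ∀ h b → pathWt h zero b [] ≡ c zero h b
  emptyPath zero true = refl
  emptyPath zero false = refl
  emptyPath (suc h) b = refl

  pathsWt : ∀ L W h b → W ≤ L → lsum (pathWt h W b) (allWordsUpTo L) ≡ c W h b
  pathsWt zero zero h b _ = trans (+-identityʳ _) (emptyPath h b)
  pathsWt (suc L) zero h b _ = begin
    lsum (pathWt h zero b) (allWordsUpTo (suc L))   ≡⟨ lsum-allWordsUpTo-suc (pathWt h zero b) L ⟩
    pathWt h zero b [] + lsum (λ _ → 0) (allWordsUpTo L)  ≡⟨ cong₂ _+_ (emptyPath h b) (lsum-zero (allWordsUpTo L)) ⟩
    c zero h b + 0                                   ≡⟨ +-identityʳ _ ⟩
    c zero h b ∎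
  pathsWt (suc L) (suc W) h b (s≤s W≤L) = begin
    lsum (pathWt h (suc W) b) (allWordsUpTo (suc L))
      ≡⟨ lsum-allWordsUpTo-suc (pathWt h (suc W) b) L ⟩
    lsum (firstSteps (pathWt h (suc W) b)) (allWordsUpTo L)
      ≡⟨ lsum-cong (allWordsUpTo L) (λ w → cong₂ _+_ (pathWt-U h W b w)
                     (cong₂ _+_ (pathWt-D h W b w) (trans (+-identityʳ _) (pathWt-F h W b w)))) ⟩
    lsum (λ w → pathWt (suc h) W true w + (afterDWt W h b w + afterFWt W h w)) (allWordsUpTo L)
      ≡⟨ lsum-+ (pathWt (suc h) W true) _ (allWordsUpTo L) ⟩
    lsum (pathWt (suc h) W true) (allWordsUpTo L) + lsum (λ w → afterDWt W h b w + afterFWt W h w) (allWordsUpTo L)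
      ≡⟨ cong (lsum (pathWt (suc h) W true) (allWordsUpTo L) +_) (lsum-+ (afterDWt W h b) (afterFWt W h) (allWordsUpTo L)) ⟩
    lsum (pathWt (suc h) W true) (allWordsUpTo L) + (lsum (afterDWt W h b) (allWordsUpTo L) + lsum (afterFWt W h) (allWordsUpTo L))
      ≡⟨ cong₂ _+_ (pathsWt L W (suc h) true W≤L) (cong₂ _+_ (downs h) (flats W W≤L)) ⟩
    c W (suc h) true + (afterD W h b + afterF W h) ∎
    where
    downs : ∀ h → lsum (afterDWt W h b) (allWordsUpTo L) ≡ afterD W h b
    downs zero = lsum-zero (allWordsUpTo L)
    downs (suc h) = trans (lsum-* (tᵇ b) (pathWt h W false) (allWordsUpTo L)) (cong (tᵇ b *_) (pathsWt L W h false W≤L))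
    flats : ∀ W → W ≤ L → lsum (afterFWt W h) (allWordsUpTo L) ≡ afterF W h
    flats zero _ = lsum-zero (allWordsUpTo L)
    flats (suc W) W<L = pathsWt L W h false (≤-trans (n≤1+n W) W<L)

  tooLow : ∀ W h b → W < h → c W h b ≡ 0
  tooLow zero (suc h) b _ = refl
  tooLow (suc W) (suc h) b (s≤s W<h) =
    cong₂ _+_ (tooLow W (suc (suc h)) true (m<n⇒m<1+n (m<n⇒m<1+n W<h)))
              (cong₂ _+_ (trans (cong (tᵇ b *_) (tooLow W h false W<h)) (*-zeroʳ (tᵇ b))) (noFlat W W<h))
    where
    noFlat : ∀ W → W < h → afterF W (suc h) ≡ 0
    noFlat zero _ = refl
    noFlat (suc W) W<h = tooLow W (suc h) false (m<n⇒m<1+n (≤-trans (n≤1+n (suc W)) W<h))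

  -- Indexing by semilength: cs n h b is the weight of paths from height h
  -- down to 0 with n up-or-flat units, i.e. of width 2n + h.
  cs : ℕ → ℕ → Bool → ℕ
  cs n h b = c (n + n + h) h b

  Sch : ℕ → ℕ
  Sch n = cs n zero false

  schroederTotal : ∀ m → lsum (weight (isSchroeder m) peaks t) (allWordsUpTo (m + m)) ≡ Sch m
  schroederTotal m = trans (pathsWt (m + m) (m + m) zero false ≤-refl)
                           (cong (λ W → c W zero false) (sym (+-identityʳ (m + m))))

  -- with no units to spend, the only path is Dʰ
  cs-zero-suc : ∀ h b → cs zero (suc h) b ≡ tᵇ b * cs zero h false
  cs-zero-suc h b = begin
    c h (suc (suc h)) true + (tᵇ b * c h h false + afterF h (suc h))
      ≡⟨ cong₂ (λ x y → x + (tᵇ b * c h h false + y)) (tooLow h (suc (suc h)) true (m<n⇒m<1+n (n<1+n h))) (noFlat h) ⟩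
    tᵇ b * c h h false + 0  ≡⟨ +-identityʳ _ ⟩
    tᵇ b * c h h false ∎
    where
    noFlat : ∀ h → afterF h (suc h) ≡ 0
    noFlat zero = refl
    noFlat (suc h) = tooLow h (suc (suc h)) false (m<n⇒m<1+n (n<1+n h))

  -- Dʰ not preceded by U has no peak
  cs-zero-false : ∀ h → cs zero h false ≡ 1
  cs-zero-false zero = refl
  cs-zero-false (suc h) = trans (cs-zero-suc h false) (trans (*-identityˡ _) (cs-zero-false h))

  -- U Dʰ⁺¹ has exactly one peak
  cs-zero-true : ∀ h → cs zero (suc h) true ≡ t
  cs-zero-true h = trans (cs-zero-suc h true) (trans (cong (t *_) (cs-zero-false h)) (*-identityʳ t))

  cs-suc : ∀ n h b → cs (suc n) h b ≡ c (suc (suc (n + n + h))) h b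
  cs-suc n h b = cong (λ x → c (suc (x + h)) h b) (+-suc n n)

  cs-suc-zero : ∀ n b → cs (suc n) zero b ≡ cs n 1 true + cs n zero false
  cs-suc-zero n b = trans (cs-suc n zero b)
    (cong (λ x → c x 1 true + c (n + n + zero) zero false) (sym (+-suc (n + n) zero)))

  cs-suc-suc : ∀ n h b →
    cs (suc n) (suc h) b ≡ cs n (suc (suc h)) true + (tᵇ b * cs (suc n) h false + cs n (suc h) false)
  cs-suc-suc n h b = trans (cs-suc n (suc h) b)
    (cong₂ (λ x y → c x (suc (suc h)) true + (tᵇ b * c y h false + c (n + n + suc h) (suc h) false))
           (sym (+-suc (n + n) (suc h)))
           (trans (cong suc (+-suc (n + n) h)) (sym (cong (λ x → suc (x + h)) (+-suc n n)))))

-- Both totals satisfy the same convolution recurrence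

module Comparison (t : ℕ) where
  open InversionSide t using (I)
  open SchroederSide t using (tᵇ; cs; Sch; cs-zero-suc; cs-zero-false; cs-zero-true; cs-suc-zero; cs-suc-suc)

  s : ℕ
  s = suc t

  passageStep : ∀ n h b →
    cs n (suc (suc (suc h))) true ≡ conv (λ j → cs j (suc (suc h)) true) Sch n →
    cs (suc n) (suc h) false ≡ conv (λ j → cs j h false) Sch (suc n) →
    cs n (suc (suc h)) false ≡ conv (λ j → cs j (suc h) false) Sch n →
    cs (suc n) (suc (suc h)) b ≡ conv (λ j → cs j (suc h) b) Sch (suc n)
  passageStep n h b afterU afterD afterF = begin
    cs (suc n) (suc (suc h)) b
      ≡⟨ cs-suc-suc n (suc h) b ⟩
    cs n (suc (suc (suc h))) true + (tᵇ b * cs (suc n) (suc h) false + cs n (suc (suc h)) false)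
      ≡⟨ cong₂ (λ x y → x + (tᵇ b * y + cs n (suc (suc h)) false)) afterU afterD ⟩
    X + (tᵇ b * (c₀ * Sch (suc n) + Y) + cs n (suc (suc h)) false)
      ≡⟨ cong (λ z → X + (tᵇ b * (c₀ * Sch (suc n) + Y) + z)) afterF ⟩
    X + (tᵇ b * (c₀ * Sch (suc n) + Y) + Z)
      ≡⟨ solve 6 (λ x y z u c₀ σ → x :+ (u :* (c₀ :* σ :+ y) :+ z) := (u :* c₀) :* σ :+ (x :+ (u :* y :+ z)))
               refl X Y Z (tᵇ b) c₀ (Sch (suc n)) ⟩
    (tᵇ b * c₀) * Sch (suc n) + (X + (tᵇ b * Y + Z))
      ≡⟨ cong₂ (λ a x → a * Sch (suc n) + x) (sym (cs-zero-suc h b))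
               (sym (conv-combination (λ j → cs j (suc (suc h)) true) (λ j → cs (suc j) h false)
                                      (λ j → cs j (suc h) false) (tᵇ b) Sch n)) ⟩
    cs zero (suc h) b * Sch (suc n)
      + conv (λ j → cs j (suc (suc h)) true + (tᵇ b * cs (suc j) h false + cs j (suc h) false)) Sch n
      ≡⟨ cong (cs zero (suc h) b * Sch (suc n) +_) (conv-cong Sch n (λ j → sym (cs-suc-suc j h b))) ⟩
    conv (λ j → cs j (suc h) b) Sch (suc n) ∎
    where
    c₀ : ℕ
    c₀ = cs zero h false
    X : ℕ
    X = conv (λ j → cs j (suc (suc h)) true) Sch n
    Y : ℕ
    Y = conv (λ j → cs (suc j) h false) Sch n
    Z : ℕ
    Z = conv (λ j → cs j (suc h) false) Sch n

  -- First-passage decomposition: a path from height h+1 reaches height 0 for the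
  -- first time by a D step after a (lifted) path from h; a Schröder path follows.
  -- When the path is preceded by U, this needs h ≥ 1 so that the D step is no peak.
  firstPassage : ∀ n h → cs n (suc h) false ≡ conv (λ j → cs j h false) Sch n
  firstPassageAfterU : ∀ n h → cs n (suc (suc h)) true ≡ conv (λ j → cs j (suc h) true) Sch n

  firstPassage zero h = trans (cs-zero-false (suc h)) (sym (cong (λ x → x * 1 + 0) (cs-zero-false h)))
  firstPassage (suc n) zero = begin
    cs (suc n) 1 false
      ≡⟨ cs-suc-suc n zero false ⟩
    cs n 2 true + (1 * Sch (suc n) + cs n 1 false)
      ≡⟨ cong₂ (λ x y → x + (1 * Sch (suc n) + y)) (firstPassageAfterU n zero) (firstPassage n zero) ⟩
    X + (1 * Sch (suc n) + Y)
      ≡⟨ solve 3 (λ x y σ → x :+ (con 1 :* σ :+ y) := con 1 :* σ :+ (x :+ y)) refl X Y (Sch (suc n)) ⟩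
    1 * Sch (suc n) + (X + Y)
      ≡⟨ cong (1 * Sch (suc n) +_) (sym (conv-+ (λ j → cs j 1 true) (λ j → cs j zero false) Sch n)) ⟩
    1 * Sch (suc n) + conv (λ j → cs j 1 true + cs j zero false) Sch n
      ≡⟨ cong (1 * Sch (suc n) +_) (conv-cong Sch n (λ j → sym (cs-suc-zero j false))) ⟩
    conv (λ j → cs j zero false) Sch (suc n) ∎
    where
    X : ℕ
    X = conv (λ j → cs j 1 true) Sch n
    Y : ℕ
    Y = conv (λ j → cs j zero false) Sch n
  firstPassage (suc n) (suc h) =
    passageStep n h false (firstPassageAfterU n (suc h)) (firstPassage (suc n) h) (firstPassage n (suc h))

  firstPassageAfterU zero h =
    trans (cs-zero-true (suc h)) (sym (trans (cong (λ x → x * 1 + 0) (cs-zero-true h)) (trans (+-identityʳ _) (*-identityʳ t))))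
  firstPassageAfterU (suc n) h =
    passageStep n h true (firstPassageAfterU n (suc h)) (firstPassage (suc n) h) (firstPassage n (suc h))

  Sch-recurrence : ∀ k → Sch (suc (suc k)) ≡ t * Sch (suc k) + conv (Sch ∘ suc) Sch k + Sch (suc k)
  Sch-recurrence k = begin
    Sch (suc (suc k))
      ≡⟨ cs-suc-zero (suc k) false ⟩
    cs (suc k) 1 true + Sch (suc k)
      ≡⟨ cong (_+ Sch (suc k)) (cs-suc-suc k zero true) ⟩
    (cs k 2 true + (t * Sch (suc k) + cs k 1 false)) + Sch (suc k)
      ≡⟨ cong₂ (λ x y → (x + (t * Sch (suc k) + y)) + Sch (suc k)) (firstPassageAfterU k zero) (firstPassage k zero) ⟩
    (X + (t * Sch (suc k) + Y)) + Sch (suc k)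
      ≡⟨ solve 4 (λ x y a b → (x :+ (a :+ y)) :+ b := (a :+ (x :+ y)) :+ b) refl X Y (t * Sch (suc k)) (Sch (suc k)) ⟩
    (t * Sch (suc k) + (X + Y)) + Sch (suc k)
      ≡⟨ cong (λ z → t * Sch (suc k) + z + Sch (suc k))
              (trans (sym (conv-+ (λ j → cs j 1 true) (λ j → cs j zero false) Sch k))
                     (conv-cong Sch k (λ j → sym (cs-suc-zero j false)))) ⟩
    t * Sch (suc k) + conv (Sch ∘ suc) Sch k + Sch (suc k) ∎
    where
    X : ℕ
    X = conv (λ j → cs j 1 true) Sch k
    Y : ℕ
    Y = conv (λ j → cs j zero false) Sch k

  T : ℕ → ℕ
  T a = I a 1

  V : ℕ → ℕ
  V zero = 1
  V (suc a) = T a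

  I-local : ∀ n k → I (suc n) (suc (suc k)) + t * I n (suc (suc k)) ≡ I (suc n) (suc k) + s * I n (suc (suc (suc k)))
  I-local n k = solve 4 (λ u a b r → (u :* a :+ (a :+ (b :+ r))) :+ u :* b := (u :* b :+ (b :+ r)) :+ (con 1 :+ u) :* a)
    refl t (I n (suc (suc (suc k)))) (I n (suc (suc k))) (sumTo (λ j → I n (suc k ∸ j)) (suc k))

  I-firstPassage : ∀ n k → I n (suc (suc k)) ≡ conv (λ a → I a (suc k)) V n
  I-firstPassage zero k = refl
  I-firstPassage (suc n) zero = begin
    t * I n 3 + (I n 3 + (I n 2 + (T n + 0)))
      ≡⟨ solve 4 (λ u a b c → u :* a :+ (a :+ (b :+ (c :+ con 0))) := con 1 :* c :+ ((con 1 :+ u) :* a :+ b))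
               refl t (I n 3) (I n 2) (T n) ⟩
    1 * T n + (s * I n 3 + I n 2)
      ≡⟨ cong (λ x → 1 * T n + x) (cong₂ (λ a b → s * a + b) (I-firstPassage n 1) (I-firstPassage n zero)) ⟩
    1 * T n + (s * conv (λ a → I a 2) V n + conv T V n)
      ≡⟨ cong (1 * T n +_) (sym (trans (conv-+ (λ a → s * I a 2) T V n) (cong (_+ conv T V n) (conv-* s (λ a → I a 2) V n)))) ⟩
    1 * T n + conv (λ a → s * I a 2 + T a) V n
      ≡⟨ cong (1 * T n +_) (conv-cong V n (λ a → solve 3 (λ u x y → (con 1 :+ u) :* x :+ y := u :* x :+ (x :+ (y :+ con 0)))
                                                          refl t (I a 2) (T a))) ⟩
    conv T V (suc n) ∎
  I-firstPassage (suc n) (suc k) = +-cancelʳ-≡ (t * I n (suc (suc (suc k)))) _ _ (begin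
    I (suc n) (suc (suc (suc k))) + t * I n (suc (suc (suc k)))
      ≡⟨ I-local n (suc k) ⟩
    I (suc n) (suc (suc k)) + s * I n (suc (suc (suc (suc k))))
      ≡⟨ cong₂ (λ x y → x + s * y) (I-firstPassage (suc n) k) (I-firstPassage n (suc (suc k))) ⟩
    (1 * T n + conv (λ a → I (suc a) (suc k)) V n) + s * conv (λ a → I a (suc (suc (suc k)))) V n
      ≡⟨ +-assoc (1 * T n) _ _ ⟩
    1 * T n + (conv (λ a → I (suc a) (suc k)) V n + s * conv (λ a → I a (suc (suc (suc k)))) V n)
      ≡⟨ cong (1 * T n +_) (sym (trans (conv-+ (λ a → I (suc a) (suc k)) (λ a → s * I a (suc (suc (suc k)))) V n)
                                        (cong (conv (λ a → I (suc a) (suc k)) V n +_) (conv-* s (λ a → I a (suc (suc (suc k)))) V n)))) ⟩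
    1 * T n + conv (λ a → I (suc a) (suc k) + s * I a (suc (suc (suc k)))) V n
      ≡⟨ cong (1 * T n +_) (conv-cong V n (λ a → sym (I-local a k))) ⟩
    1 * T n + conv (λ a → I (suc a) (suc (suc k)) + t * I a (suc (suc k))) V n
      ≡⟨ cong (1 * T n +_) (trans (conv-+ (λ a → I (suc a) (suc (suc k))) (λ a → t * I a (suc (suc k))) V n)
                                   (cong (conv (λ a → I (suc a) (suc (suc k))) V n +_) (conv-* t (λ a → I a (suc (suc k))) V n))) ⟩
    1 * T n + (conv (λ a → I (suc a) (suc (suc k))) V n + t * conv (λ a → I a (suc (suc k))) V n)
      ≡⟨ sym (+-assoc (1 * T n) _ _) ⟩
    conv (λ a → I a (suc (suc k))) V (suc n) + t * conv (λ a → I a (suc (suc k))) V n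
      ≡⟨ cong (λ x → conv (λ a → I a (suc (suc k))) V (suc n) + t * x) (sym (I-firstPassage n (suc k))) ⟩
    conv (λ a → I a (suc (suc k))) V (suc n) + t * I n (suc (suc (suc k))) ∎)

  T-recurrence : ∀ n → T (suc n) ≡ s * conv T V n + T n
  T-recurrence n = begin
    t * I n 2 + (I n 2 + (T n + 0))   ≡⟨ solve 3 (λ u a b → u :* a :+ (a :+ (b :+ con 0)) := (con 1 :+ u) :* a :+ b) refl t (I n 2) (T n) ⟩
    s * I n 2 + T n                   ≡⟨ cong (λ x → s * x + T n) (I-firstPassage n zero) ⟩
    s * conv T V n + T n ∎

  -- I (r+1) 0 = (1+t)·T r: a new zero or a new maximum, both leading to slack 1
  I-suc-zero : ∀ r → I (suc r) zero ≡ s * T r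
  I-suc-zero r = solve 2 (λ u a → u :* a :+ (a :+ con 0) := (con 1 :+ u) :* a) refl t (T r)

  -- Sch 1 = t + 1 (the paths UD and F)
  Sch-one : Sch 1 ≡ s * T 0
  Sch-one = trans (cs-suc-zero zero false) (trans (cong (_+ 1) (cs-zero-true zero)) (solve 1 (λ u → u :+ con 1 := (con 1 :+ u) :* con 1) refl t))

  Sch-step : ∀ k → (∀ j → j ≤ k → Sch (suc j) ≡ s * T j) → Sch (suc (suc k)) ≡ s * T (suc k)
  Sch-step k ih = begin
    Sch (suc (suc k))
      ≡⟨ Sch-recurrence k ⟩
    t * Sch (suc k) + conv (Sch ∘ suc) Sch k + Sch (suc k)
      ≡⟨ cong (λ x → t * Sch (suc k) + x + Sch (suc k)) (conv-peelLast (Sch ∘ suc) Sch k) ⟩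
    t * Sch (suc k) + (sumTo (λ a → Sch (suc a) * Sch (suc (k ∸ suc a))) k + Sch (suc k) * 1) + Sch (suc k)
      ≡⟨ cong₂ (λ x y → t * y + (x + y * 1) + y) products (ih k ≤-refl) ⟩
    t * (s * T k) + ((s * s) * Σ′ + (s * T k) * 1) + s * T k
      ≡⟨ solve 3 (λ u a b → u :* ((con 1 :+ u) :* a) :+ (((con 1 :+ u) :* (con 1 :+ u)) :* b :+ ((con 1 :+ u) :* a) :* con 1)
                               :+ (con 1 :+ u) :* a
                            := (con 1 :+ u) :* ((con 1 :+ u) :* (b :+ a :* con 1) :+ a)) refl t (T k) Σ′ ⟩
    s * (s * (Σ′ + T k * 1) + T k)
      ≡⟨ cong (λ x → s * (s * x + T k)) (sym (conv-peelLast T V k)) ⟩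
    s * (s * conv T V k + T k)
      ≡⟨ cong (s *_) (sym (T-recurrence k)) ⟩
    s * T (suc k) ∎
    where
    Σ′ : ℕ
    Σ′ = sumTo (λ a → T a * T (k ∸ suc a)) k
    products : sumTo (λ a → Sch (suc a) * Sch (suc (k ∸ suc a))) k ≡ (s * s) * Σ′
    products = trans (sumTo-cong< k (λ a a<k → trans (cong₂ _*_ (ih a (<⇒≤ a<k)) (ih (k ∸ suc a) (m∸n≤m k (suc a))))
                                                      (solve 3 (λ u x y → (u :* x) :* (u :* y) := (u :* u) :* (x :* y)) refl s (T a) (T (k ∸ suc a)))))
                     (sumTo-* (s * s) (λ a → T a * T (k ∸ suc a)) k)

  Sch≡sT : ∀ k j → j ≤ k → Sch (suc j) ≡ s * T j
  Sch≡sT zero zero _ = Sch-one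
  Sch≡sT (suc k) j j≤1+k with m≤n⇒m<n∨m≡n j≤1+k
  ... | inj₁ (s≤s j≤k) = Sch≡sT k j j≤k
  ... | inj₂ refl = Sch-step k (Sch≡sT k)

  I≡Sch : ∀ m → I m zero ≡ Sch m
  I≡Sch zero = refl
  I≡Sch (suc r) = trans (I-suc-zero r) (sym (Sch≡sT r r ≤-refl))

generatingIdentity : ∀ t m →
  lsum (weight (not ∘ contains021) zeros t) (invSeqs (suc m))
    ≡ t * lsum (weight (isSchroeder m) peaks t) (allWordsUpTo (m + m))
generatingIdentity t m = begin
  lsum (weight (not ∘ contains021) zeros t) (invSeqs (suc m))       ≡⟨ InversionSide.inversionTotal t m ⟩
  t * InversionSide.I t m zero                                       ≡⟨ cong (t *_) (Comparison.I≡Sch t m) ⟩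
  t * SchroederSide.Sch t m                                          ≡⟨ cong (t *_) (sym (SchroederSide.schroederTotal t m)) ⟩
  t * lsum (weight (isSchroeder m) peaks t) (allWordsUpTo (m + m)) ∎

-- Reading off the coefficient of t^{k+1} at a base t exceeding all counts.
corollary1 : (n k : ℕ) → countInv021 (suc n) (suc k) ≡ countSchroeder n k
corollary1 n k = coefficients-agree (not ∘ contains021) zeros (isSchroeder n) (suc ∘ peaks) seqs paths B
  (s≤s (m≤m+n _ _)) (s≤s (m≤n+m _ _)) shiftedIdentity (suc k)
  where
  seqs : List (List ℕ)
  seqs = invSeqs (suc n)
  paths : List (List Step)
  paths = allWordsUpTo (n + n)
  B : ℕ
  B = suc (length seqs + length paths)
  shiftedIdentity : lsum (weight (not ∘ contains021) zeros B) seqs ≡ lsum (weight (isSchroeder n) (suc ∘ peaks) B) paths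
  shiftedIdentity = begin
    lsum (weight (not ∘ contains021) zeros B) seqs        ≡⟨ generatingIdentity B n ⟩
    B * lsum (weight (isSchroeder n) peaks B) paths       ≡⟨ sym (lsum-* B (weight (isSchroeder n) peaks B) paths) ⟩
    lsum (λ w → B * weight (isSchroeder n) peaks B w) paths
      ≡⟨ lsum-cong paths (λ w → sym (if-* (isSchroeder n w) B (B ^ peaks w))) ⟩
    lsum (weight (isSchroeder n) (suc ∘ peaks) B) paths ∎
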